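{- For every integer $n\equiv 0\pmod 4$ with $n\geq 8$, there exists a circulant graph of order $n$ which is regular of degree $n-4$ and is doubly Eulerian (an edge-maximal doubly Eulerian circulant graph of order $n$).
   Context: All graphs are finite, simple and connected. A circulant graph of order $n$ is a Cayley graph on the cyclic group $\mathbb{Z}_n$. An Eulerian circuit is a closed trail traversing every edge exactly once. Let $G$ be Eulerian with $m$ edges and $u$ a vertex. Two Eulerian circuits $u,v_1,\ldots,v_{m-1},u$ and $u,w_1,\ldots,w_{m-1},u$ are avoiding if for every $1\le i\le m-1$, $v_i\neq w_i$ and $v_i$ is not adjacent to $w_i$. $G$ is doubly Eulerian if for every vertex $u$ there is a pair of avoiding Eulerian circuits starting and ending at $u$. For even $n$, a doubly Eulerian graph of order $n$ is edge-maximal if it is regular of degree $n-4$ (the maximum possible). -}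

module Defs where

open import Data.Nat using (ℕ; zero; suc; _+_; _∸_; _<_; _≤_; NonZero)
open import Data.Nat.DivMod using (_mod_)
open import Data.Fin using (Fin; toℕ; fromℕ; inject₁) renaming (zero to fzero; suc to fsuc)
open import Data.Fin.Subset using (Subset; _∈_; _∉_; ∣_∣)
open import Data.Vec using (tabulate; lookup)
open import Data.Product using (Σ; ∃; _×_; _,_)
open import Data.Sum using (_⊎_)
open import Relation.Binary.PropositionalEquality using (_≡_; _≢_)
open import Relation.Nullary using (¬_)

module GraphNotions {n : ℕ} (Adj : Fin n → Fin n → Set) where

  SameEdge : Fin n → Fin n → Fin n → Fin n → Set
  SameEdge x y a b = (x ≡ a × y ≡ b) ⊎ (x ≡ b × y ≡ a)

  Connected : Set
  Connected = ∀ (x y : Fin n) →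
    Σ ℕ λ k → Σ (Fin (suc k) → Fin n) λ p →
      (p fzero ≡ x) × (p (fromℕ k) ≡ y) ×
      (∀ (i : Fin k) → Adj (p (inject₁ i)) (p (fsuc i)))

  -- w : Fin (suc m) → Fin n is the closed walk u = w 0, w 1, …, w m = u
  -- which traverses every edge of the graph exactly once
  -- (m is then necessarily the number of edges).
  IsEulerianCircuit : Fin n → (m : ℕ) → (Fin (suc m) → Fin n) → Set
  IsEulerianCircuit u m w =
    (w fzero ≡ u) × (w (fromℕ m) ≡ u) ×
    (∀ (i : Fin m) → Adj (w (inject₁ i)) (w (fsuc i))) ×
    (∀ (i j : Fin m) →
       SameEdge (w (inject₁ i)) (w (fsuc i)) (w (inject₁ j)) (w (fsuc j)) →
       i ≡ j) ×
    (∀ (a b : Fin n) → Adj a b →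
       Σ (Fin m) λ i → SameEdge (w (inject₁ i)) (w (fsuc i)) a b)

  Avoiding : (m : ℕ) → (Fin (suc m) → Fin n) → (Fin (suc m) → Fin n) → Set
  Avoiding m v w = ∀ (i : Fin (suc m)) → 0 < toℕ i → toℕ i < m →
    (v i ≢ w i) × ¬ Adj (v i) (w i)

  DoublyEulerian : Set
  DoublyEulerian = ∀ (u : Fin n) →
    Σ ℕ λ m → Σ (Fin (suc m) → Fin n) λ v → Σ (Fin (suc m) → Fin n) λ w →
      IsEulerianCircuit u m v × IsEulerianCircuit u m w × Avoiding m v w

-- Circulant graphs Cay(ℤ_n, S).  ℤ_n is represented by Fin n with
-- arithmetic mod n.

module _ {n : ℕ} .{{_ : NonZero n}} where

  negₙ : Fin n → Fin n
  negₙ s = (n ∸ toℕ s) mod n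

  _⊖_ : Fin n → Fin n → Fin n
  y ⊖ x = (toℕ y + (n ∸ toℕ x)) mod n

  -- a connection set: 0 ∉ S and S = -S (so the Cayley graph is simple)
  IsConnectionSet : Subset n → Set
  IsConnectionSet S = ((0 mod n) ∉ S) × (∀ (s : Fin n) → s ∈ S → negₙ s ∈ S)

  CayAdj : Subset n → Fin n → Fin n → Set
  CayAdj S x y = (y ⊖ x) ∈ S

  neighbours : Subset n → Fin n → Subset n
  neighbours S x = tabulate (λ y → lookup S (y ⊖ x))

  degree : Subset n → Fin n → ℕ
  degree S x = ∣ neighbours S x ∣

  IsRegular : Subset n → ℕ → Set
  IsRegular S d = ∀ (x : Fin n) → degree S x ≡ d

-- Cay(ℤ_{4r}, {z : r ∤ z}) is the complete multipartite graph K_{r×4}, whose parts are the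
-- residue classes mod r; so it is (n − 4)-regular, and since K_{r×4} is vertex-transitive it
-- suffices to find two avoiding Euler circuits at a single vertex. They are built by induction
-- on r ≥ 2 from an explicit pair for K_{2×4}. To add a part, place one copy of a fixed Euler
-- circuit of K_{2×4} between each old part and the new one: together the copies form a closed
-- trail through exactly the new edges. Splice it into the first circuit right after its first
-- step and splice its colour reversal into the second; reversal keeps every vertex in its part
-- but moves it, so the spliced stretches stay avoiding.

module Submission where

open import Defs
open import Data.Bool using (Bool; true; false; not; if_then_else_)
open import Data.Empty using (⊥-elim)
open import Data.Fin using (Fin; toℕ; fromℕ; fromℕ<; inject₁; lower₁; cast; combine; remQuot)
  renaming (zero to fzero; suc to fsuc)
open import Data.Fin.Patterns using (0F; 1F; 2F; 3F)
open import Data.Fin.Permutation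
  using (Permutation′; _⟨$⟩ʳ_; _⟨$⟩ˡ_; inverseˡ; inverseʳ; transpose; reverse)
  renaming (id to idₚ)
open import Data.Fin.Properties
  using ( toℕ-fromℕ; toℕ-fromℕ<; toℕ-inject₁; toℕ-injective; toℕ<n; fromℕ≢inject₁
        ; inject₁-injective; inject₁-lower₁; toℕ-cast; cast-involutive; toℕ-combine
        ; remQuot-combine; combine-remQuot )
  renaming (_≟_ to _≟ᶠ_; all? to ∀-Fin?)
open import Data.Fin.Subset using (Subset; _∈_; _∉_; ∣_∣; ∁)
open import Data.Fin.Subset.Properties using (∣∁p∣≡n∸∣p∣)
open import Data.List using (List; []; _∷_; _++_; _∷ʳ_; [_]; map; concat; tabulate; drop; length)
open import Data.List.Properties using (map-++; length-++; ++-assoc; map-tabulate; tabulate-cong)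
import Data.List.Relation.Unary.All as All
open All using (All; []; _∷_)
import Data.List.Relation.Unary.All.Properties as All
import Data.List.Relation.Unary.Any as Any
open Any using (Any; here; there)
import Data.List.Relation.Unary.Any.Properties as Any
import Data.List.Relation.Unary.AllPairs as AllPairs
open AllPairs using (AllPairs; []; _∷_)
import Data.List.Relation.Unary.AllPairs.Properties as AllPairs
import Data.List.Relation.Binary.Pointwise as Pointwise
open Pointwise using (Pointwise; []; _∷_; Pointwise-length)
import Data.List.Relation.Binary.Pointwise.Properties as Pointwise
open import Data.List.Relation.Binary.Permutation.Propositional
  using (_↭_; ↭-trans; ↭-reflexive; ↭-prep; ↭-sym; ↭⇒↭ₛ)
open import Data.List.Relation.Binary.Permutation.Propositional.Properties
  using (All-resp-↭; Any-resp-↭; ∷↭∷ʳ; ++-comm)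
import Data.List.Relation.Binary.Permutation.Setoid.Properties as ↭ₛ
open import Data.Nat
  using (ℕ; zero; suc; _+_; _*_; _∸_; _<_; _≤_; _≟_; NonZero; s≤s; z≤n; s<s; z<s; >-nonZero; >-nonZero⁻¹)
open import Data.Nat.Properties
  using ( +-comm; +-assoc; +-cancelʳ-≡; *-comm; *-identityʳ; <⇒≱; <⇒≤; m≤m+n; m∸n+n≡m; m*n≢0
        ; ≤-trans )
open import Data.Nat.DivMod
  using ( _%_; _/_; _mod_; m≡m%n+[m/n]*n; m%n%n≡m%n; %-distribˡ-+; %-remove-+ˡ; %-remove-+ʳ
        ; m%n<n; m<n⇒m%n≡m; m∣n⇒o%n%m≡o%m; [m+n]%n≡m%n )
open import Data.Nat.Divisibility using (_∣_; divides; m∣m*n)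
open import Data.Product using (Σ; ∃; ∃₂; _×_; _,_; proj₁; proj₂; uncurry)
import Data.Product as Product
open import Data.Product.Properties using (≡-dec)
open import Data.Sum using (_⊎_; inj₁; inj₂)
import Data.Sum as Sum
open import Data.Unit using (⊤; tt)
import Data.Vec as Vec
import Data.Vec.Properties as Vec
open import Function using (_∘_; _⇔_; mk⇔; Equivalence)
open import Relation.Binary.Definitions using (Symmetric; Decidable; DecidableEquality)
open import Relation.Binary.PropositionalEquality
  using (_≡_; _≢_; refl; sym; trans; cong; cong₂; subst; subst₂; setoid; resp₂; module ≡-Reasoning)
open import Relation.Nullary using (¬_; Dec; yes; no; does)
open import Relation.Nullary.Decidable
  using (¬?; _×-dec_; _⊎-dec_; _→-dec_; map′; dec-true; from-yes; toSum; does-⇔)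

-- Walks as vertex lists

module Trails {V : Set} (Adj : V → V → Set) where

  Edge : Set
  Edge = V × V

  infix 4 _≈ₑ_ _≉ₑ_

  _≈ₑ_ : Edge → Edge → Set
  (x , y) ≈ₑ (a , b) = (x ≡ a × y ≡ b) ⊎ (x ≡ b × y ≡ a)

  _≉ₑ_ : Edge → Edge → Set
  e ≉ₑ e′ = ¬ (e ≈ₑ e′)

  ≈ₑ-sym : Symmetric _≈ₑ_
  ≈ₑ-sym (inj₁ (refl , refl)) = inj₁ (refl , refl)
  ≈ₑ-sym (inj₂ (refl , refl)) = inj₂ (refl , refl)

  ≉ₑ-sym : Symmetric _≉ₑ_
  ≉ₑ-sym e≉e′ = e≉e′ ∘ ≈ₑ-sym

  ≈ₑ-resp : ∀ {R : V → V → Set} → Symmetric R →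
            ∀ {e e′} → e ≈ₑ e′ → uncurry R e → uncurry R e′
  ≈ₑ-resp sym (inj₁ (refl , refl)) r = r
  ≈ₑ-resp sym (inj₂ (refl , refl)) r = sym r

  edges : V → List V → List Edge
  edges x []       = []
  edges x (y ∷ ys) = (x , y) ∷ edges y ys

  endpoint : V → List V → V
  endpoint x []       = x
  endpoint x (y ∷ ys) = endpoint y ys

  edges-++ : ∀ x ys zs → edges x (ys ++ zs) ≡ edges x ys ++ edges (endpoint x ys) zs
  edges-++ x []       zs = refl
  edges-++ x (y ∷ ys) zs = cong ((x , y) ∷_) (edges-++ y ys zs)

  endpoint-++ : ∀ x ys zs → endpoint x (ys ++ zs) ≡ endpoint (endpoint x ys) zs
  endpoint-++ x []       zs = refl
  endpoint-++ x (y ∷ ys) zs = endpoint-++ y ys zs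

  length-edges : ∀ x ys → length (edges x ys) ≡ length ys
  length-edges x []       = refl
  length-edges x (y ∷ ys) = cong suc (length-edges y ys)

  endpoint-∷ʳ : ∀ x ys z → endpoint x (ys ∷ʳ z) ≡ z
  endpoint-∷ʳ x ys z = endpoint-++ x ys [ z ]

  ClosedAt : V → List V → Set
  ClosedAt z ys = endpoint z ys ≡ z

  endpoint-concat : ∀ z {yss} → All (ClosedAt z) yss → ClosedAt z (concat yss)
  endpoint-concat z []                      = refl
  endpoint-concat z {ys ∷ yss} (closed ∷ cs) = begin
    endpoint z (ys ++ concat yss)           ≡⟨ endpoint-++ z ys (concat yss) ⟩
    endpoint (endpoint z ys) (concat yss)   ≡⟨ cong (λ w → endpoint w (concat yss)) closed ⟩
    endpoint z (concat yss)                 ≡⟨ endpoint-concat z cs ⟩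
    z                                       ∎
    where open ≡-Reasoning

  edges-concat : ∀ z {yss} → All (ClosedAt z) yss →
                 edges z (concat yss) ≡ concat (map (edges z) yss)
  edges-concat z []                      = refl
  edges-concat z {ys ∷ yss} (closed ∷ cs) = begin
    edges z (ys ++ concat yss)                          ≡⟨ edges-++ z ys (concat yss) ⟩
    edges z ys ++ edges (endpoint z ys) (concat yss)    ≡⟨ cong (λ w → edges z ys ++ edges w (concat yss)) closed ⟩
    edges z ys ++ edges z (concat yss)                  ≡⟨ cong (edges z ys ++_) (edges-concat z cs) ⟩
    edges z ys ++ concat (map (edges z) yss)            ∎
    where open ≡-Reasoning

  edges-rotate : ∀ a b ys → endpoint b ys ≡ a → edges a (b ∷ ys) ↭ edges b (ys ∷ʳ b)
  edges-rotate a b ys closed = ↭-trans (∷↭∷ʳ (a , b) (edges b ys)) (↭-reflexive (begin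
    edges b ys ∷ʳ (a , b)                     ≡⟨ cong (λ w → edges b ys ∷ʳ (w , b)) closed ⟨
    edges b ys ++ edges (endpoint b ys) [ b ] ≡⟨ edges-++ b ys [ b ] ⟨
    edges b (ys ∷ʳ b)                         ∎))
    where open ≡-Reasoning

  edges-splice : ∀ a b ds ys → ClosedAt b ds →
           edges a (b ∷ ds ++ ys) ↭ edges a (b ∷ ys) ++ edges b ds
  edges-splice a b ds ys closed = ↭-prep (a , b) (↭-trans (↭-reflexive (begin
    edges b (ds ++ ys)                        ≡⟨ edges-++ b ds ys ⟩
    edges b ds ++ edges (endpoint b ds) ys    ≡⟨ cong (λ w → edges b ds ++ edges w ys) closed ⟩
    edges b ds ++ edges b ys                  ∎)) (++-comm (edges b ds) (edges b ys)))
    where open ≡-Reasoning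

  record Traverses (P : V → V → Set) (es : List Edge) : Set where
    field
      adjacent : All (uncurry Adj) es
      distinct : AllPairs _≉ₑ_ es
      complete : ∀ {x y} → Adj x y → P x y → Any (_≈ₑ (x , y)) es

  open Traverses

  TraversesAll : List Edge → Set
  TraversesAll = Traverses (λ _ _ → ⊤)

  Traverses-resp-↭ : ∀ {P es ds} → es ↭ ds → Traverses P es → Traverses P ds
  Traverses-resp-↭ es↭ds t = record
    { adjacent = All-resp-↭ es↭ds (adjacent t)
    ; distinct = ↭ₛ.AllPairs-resp-↭ (setoid Edge) ≉ₑ-sym (resp₂ _≉ₑ_) (↭⇒↭ₛ es↭ds) (distinct t)
    ; complete = λ xy p → Any-resp-↭ es↭ds (complete t xy p)
    }

  Traverses-weaken : ∀ {P Q es} → (∀ {x y} → Adj x y → Q x y → P x y) →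
                     Traverses P es → Traverses Q es
  Traverses-weaken Q⇒P t = record
    { adjacent = adjacent t ; distinct = distinct t
    ; complete = λ xy q → complete t xy (Q⇒P xy q) }

  Separated : List Edge → List Edge → Set
  Separated es ds = All (λ e → All (e ≉ₑ_) ds) es

  separated : ∀ {R R′ : V → V → Set} → Symmetric R′ →
              (∀ {x y} → R x y → ¬ R′ x y) →
              ∀ {es ds} → All (uncurry R) es → All (uncurry R′) ds → Separated es ds
  separated sym exclusive Res R′ds = All.map (λ r → All.map (λ r′ e≈e′ →
    exclusive r (≈ₑ-resp sym (≈ₑ-sym e≈e′) r′)) R′ds) Res

  Traverses-++ : ∀ {P Q es ds} → Traverses P es → Traverses Q ds → Separated es ds →
        Traverses (λ x y → P x y ⊎ Q x y) (es ++ ds)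
  Traverses-++ {es = es} t u sep = record
    { adjacent = All.++⁺ (adjacent t) (adjacent u)
    ; distinct = AllPairs.++⁺ (distinct t) (distinct u) sep
    ; complete = λ { xy (inj₁ p) → Any.++⁺ˡ (complete t xy p)
                   ; xy (inj₂ q) → Any.++⁺ʳ es (complete u xy q) }
    }

  Traverses-concat : ∀ {k} {P : Fin k → V → V → Set} {F : Fin k → List Edge} →
                     (∀ i → Traverses (P i) (F i)) →
                     (∀ {i j} → i ≢ j → Separated (F i) (F j)) →
                     Traverses (λ x y → ∃ λ i → P i x y) (concat (tabulate F))
  Traverses-concat t sep = record
    { adjacent = All.concat⁺ (All.tabulate⁺ (adjacent ∘ t))
    ; distinct = AllPairs.concat⁺ (All.tabulate⁺ (distinct ∘ t)) (AllPairs.tabulate⁺ sep)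
    ; complete = λ { xy (i , p) → Any.concat⁺ (Any.tabulate⁺ i (complete (t i) xy p)) }
    }

  Avoid : V → V → Set
  Avoid x y = x ≢ y × ¬ Adj x y

  record AvoidingCircuits (a : V) (ps qs : List V) : Set where
    field
      circuit₁ : TraversesAll (edges a (ps ∷ʳ a))
      circuit₂ : TraversesAll (edges a (qs ∷ʳ a))
      avoiding : Pointwise Avoid ps qs

  HasAvoidingCircuits : V → Set
  HasAvoidingCircuits a = ∃₂ λ ps qs → AvoidingCircuits a ps qs

module TrailMaps {V W : Set} (Adj : V → V → Set) (Adj′ : W → W → Set) (f : V → W)
    (f-injective : ∀ {x y} → f x ≡ f y → x ≡ y)
    (f-homomorphism : ∀ {x y} → Adj x y → Adj′ (f x) (f y)) where

  open Trails Adj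
  open Trails Adj′ using () renaming
    (_≈ₑ_ to _≈′_; edges to edges′; endpoint to endpoint′; Traverses to Traverses′;
     TraversesAll to TraversesAll′; Avoid to Avoid′; AvoidingCircuits to AvoidingCircuits′;
     HasAvoidingCircuits to HasAvoidingCircuits′)
  open Traverses

  f₂ : V × V → W × W
  f₂ (x , y) = f x , f y

  edges-map : ∀ x xs → edges′ (f x) (map f xs) ≡ map f₂ (edges x xs)
  edges-map x []       = refl
  edges-map x (y ∷ ys) = cong ((f x , f y) ∷_) (edges-map y ys)

  endpoint-map : ∀ x xs → endpoint′ (f x) (map f xs) ≡ f (endpoint x xs)
  endpoint-map x []       = refl
  endpoint-map x (y ∷ ys) = endpoint-map y ys

  ≈ₑ-map⁺ : ∀ {e e′} → e ≈ₑ e′ → f₂ e ≈′ f₂ e′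
  ≈ₑ-map⁺ (inj₁ (refl , refl)) = inj₁ (refl , refl)
  ≈ₑ-map⁺ (inj₂ (refl , refl)) = inj₂ (refl , refl)

  ≈ₑ-map⁻ : ∀ {e e′} → f₂ e ≈′ f₂ e′ → e ≈ₑ e′
  ≈ₑ-map⁻ (inj₁ (p , q)) = inj₁ (f-injective p , f-injective q)
  ≈ₑ-map⁻ (inj₂ (p , q)) = inj₂ (f-injective p , f-injective q)

  Traverses-map : ∀ {P Q es} →
    (∀ {x′ y′} → Adj′ x′ y′ → Q x′ y′ →
       ∃₂ λ x y → f x ≡ x′ × f y ≡ y′ × Adj x y × P x y) →
    Traverses P es → Traverses′ Q (map f₂ es)
  Traverses-map lift t = record
    { adjacent = All.map⁺ (All.map f-homomorphism (adjacent t))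
    ; distinct = AllPairs.map⁺ (AllPairs.map (λ e≉e′ → e≉e′ ∘ ≈ₑ-map⁻) (distinct t))
    ; complete = λ xy q → covered (lift xy q)
    }
    where
    covered : ∀ {x′ y′} → (∃₂ λ x y → f x ≡ x′ × f y ≡ y′ × Adj x y × _) →
              Any (_≈′ (x′ , y′)) (map f₂ _)
    covered (x , y , refl , refl , xy , p) = Any.map⁺ (Any.map ≈ₑ-map⁺ (complete t xy p))

  edges-map-∷ʳ : ∀ a xs → edges′ (f a) (map f xs ∷ʳ f a) ≡ map f₂ (edges a (xs ∷ʳ a))
  edges-map-∷ʳ a xs = begin
    edges′ (f a) (map f xs ∷ʳ f a)   ≡⟨ cong (edges′ (f a)) (map-++ f xs [ a ]) ⟨
    edges′ (f a) (map f (xs ∷ʳ a))   ≡⟨ edges-map a (xs ∷ʳ a) ⟩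
    map f₂ (edges a (xs ∷ʳ a))       ∎
    where open ≡-Reasoning

  Avoid-map : (∀ {x y} → Adj′ (f x) (f y) → Adj x y) →
              ∀ {x y} → Avoid x y → Avoid′ (f x) (f y)
  Avoid-map f-reflects (x≢y , x≁y) = x≢y ∘ f-injective , x≁y ∘ f-reflects

  module Isomorphism (f⁻¹ : W → V) (f-inverse : ∀ y → f (f⁻¹ y) ≡ y)
      (f-reflects : ∀ {x y} → Adj′ (f x) (f y) → Adj x y) where

    Traverses-map-iso : ∀ {P Q es} → (∀ {x′ y′} → Q x′ y′ → P (f⁻¹ x′) (f⁻¹ y′)) →
                        Traverses P es → Traverses′ Q (map f₂ es)
    Traverses-map-iso {P} {Q} pull = Traverses-map {P = P} {Q = Q} λ {x′} {y′} xy q →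
      f⁻¹ x′ , f⁻¹ y′ , f-inverse x′ , f-inverse y′ ,
      f-reflects (subst₂ Adj′ (sym (f-inverse x′)) (sym (f-inverse y′)) xy) , pull q

    TraversesAll-map : ∀ {es} → TraversesAll es → TraversesAll′ (map f₂ es)
    TraversesAll-map = Traverses-map-iso (λ _ → tt)

    circuit-map : ∀ a xs → TraversesAll (edges a (xs ∷ʳ a)) →
                  TraversesAll′ (edges′ (f a) (map f xs ∷ʳ f a))
    circuit-map a xs t = subst TraversesAll′ (sym (edges-map-∷ʳ a xs)) (TraversesAll-map t)

    AvoidingCircuits-map : ∀ {a ps qs} → AvoidingCircuits a ps qs →
                           AvoidingCircuits′ (f a) (map f ps) (map f qs)
    AvoidingCircuits-map {a} {ps} {qs} c = record
      { circuit₁ = circuit-map a ps circuit₁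
      ; circuit₂ = circuit-map a qs circuit₂
      ; avoiding = Pointwise.map⁺ f f (Pointwise.map (Avoid-map f-reflects) avoiding)
      }
      where open AvoidingCircuits c

    HasAvoidingCircuits-map : ∀ {a} → HasAvoidingCircuits a → HasAvoidingCircuits′ (f a)
    HasAvoidingCircuits-map (_ , _ , c) = _ , _ , AvoidingCircuits-map c

module _ {n : ℕ} (Adj : Fin n → Fin n → Set) where

  open GraphNotions Adj
  open Trails Adj
  open Traverses

  at : ∀ {A : Set} → A → List A → ℕ → A
  at d []       k       = d
  at d (x ∷ xs) zero    = x
  at d (x ∷ xs) (suc k) = at d xs k

  walk : Fin n → List (Fin n) → ∀ {m} → Fin (suc m) → Fin n
  walk a xs i = at a (a ∷ xs) (toℕ i)

  DoublyEulerianAt : Fin n → Set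
  DoublyEulerianAt u =
    Σ ℕ λ m → Σ (Fin (suc m) → Fin n) λ v → Σ (Fin (suc m) → Fin n) λ w →
      IsEulerianCircuit u m v × IsEulerianCircuit u m w × Avoiding m v w

  at-edges : ∀ d d′ x ys k → k < length ys →
             at d′ (edges x ys) k ≡ (at d (x ∷ ys) k , at d (x ∷ ys) (suc k))
  at-edges d d′ x (y ∷ ys) zero    _         = refl
  at-edges d d′ x (y ∷ ys) (suc k) (s<s k<n) = at-edges d d′ y ys k k<n

  at-endpoint : ∀ d x ys → at d (x ∷ ys) (length ys) ≡ endpoint x ys
  at-endpoint d x []       = refl
  at-endpoint d x (y ∷ ys) = at-endpoint d y ys

  at-++ˡ : ∀ {A : Set} (d : A) xs ys k → k < length xs → at d (xs ++ ys) k ≡ at d xs k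
  at-++ˡ d (x ∷ xs) ys zero    _         = refl
  at-++ˡ d (x ∷ xs) ys (suc k) (s<s k<n) = at-++ˡ d xs ys k k<n

  All-at : ∀ {A : Set} {P : A → Set} d {xs} → All P xs → ∀ k → k < length xs → P (at d xs k)
  All-at d (px ∷ _)   zero    _         = px
  All-at d (_  ∷ pxs) (suc k) (s<s k<n) = All-at d pxs k k<n

  Any-at : ∀ {A : Set} {P : A → Set} d {xs} → Any P xs → ∃ λ k → k < length xs × P (at d xs k)
  Any-at d (here px) = 0 , z<s , px
  Any-at d (there p) with Any-at d p
  ... | k , k<n , pk = suc k , s<s k<n , pk

  Pointwise-at : ∀ {A : Set} {R : A → A → Set} d {xs ys} → Pointwise R xs ys →
                 ∀ k → k < length xs → R (at d xs k) (at d ys k)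
  Pointwise-at d (r ∷ _)  zero    _         = r
  Pointwise-at d (_ ∷ rs) (suc k) (s<s k<n) = Pointwise-at d rs k k<n

  distinct-at : ∀ d {es} → AllPairs _≉ₑ_ es → ∀ k l → k < length es → l < length es →
                at d es k ≈ₑ at d es l → k ≡ l
  distinct-at d _           zero    zero    _         _         _   = refl
  distinct-at d (e≉ ∷ _)    zero    (suc l) _         (s<s l<n) e≈ = ⊥-elim (All-at d e≉ l l<n e≈)
  distinct-at d (e≉ ∷ _)    (suc k) zero    (s<s k<n) _         e≈ = ⊥-elim (All-at d e≉ k k<n (≈ₑ-sym e≈))
  distinct-at d (_  ∷ ≉es)  (suc k) (suc l) (s<s k<n) (s<s l<n) e≈ = cong suc (distinct-at d ≉es k l k<n l<n e≈)

  closedTrail⇒isEulerianCircuit : ∀ a xs {m} → length xs ≡ m → ClosedAt a xs →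
                        TraversesAll (edges a xs) → IsEulerianCircuit a m (walk a xs)
  closedTrail⇒isEulerianCircuit a xs refl closed t =
    refl , ends , (λ i → subst (uncurry Adj) (edge-at i) (All-at (a , a) (adjacent t) (toℕ i) (index< i))) ,
    once , covers
    where
    es = edges a xs

    index< : ∀ (i : Fin (length xs)) → toℕ i < length es
    index< i = subst (toℕ i <_) (sym (length-edges a xs)) (toℕ<n i)

    edge-at : ∀ (i : Fin (length xs)) →
              at (a , a) es (toℕ i) ≡ (walk a xs (inject₁ i) , walk a xs (fsuc i))
    edge-at i = trans (at-edges a (a , a) a xs (toℕ i) (toℕ<n i))
                      (cong (λ k → at a (a ∷ xs) k , at a xs (toℕ i)) (sym (toℕ-inject₁ i)))

    ends : walk a xs (fromℕ (length xs)) ≡ a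
    ends = begin
      at a (a ∷ xs) (toℕ (fromℕ (length xs))) ≡⟨ cong (at a (a ∷ xs)) (toℕ-fromℕ (length xs)) ⟩
      at a (a ∷ xs) (length xs)               ≡⟨ at-endpoint a a xs ⟩
      endpoint a xs                           ≡⟨ closed ⟩
      a                                       ∎
      where open ≡-Reasoning

    once : ∀ (i j : Fin (length xs)) →
           SameEdge (walk a xs (inject₁ i)) (walk a xs (fsuc i))
                    (walk a xs (inject₁ j)) (walk a xs (fsuc j)) → i ≡ j
    once i j same = toℕ-injective (distinct-at (a , a) (distinct t) (toℕ i) (toℕ j) (index< i) (index< j)
      (subst₂ _≈ₑ_ (sym (edge-at i)) (sym (edge-at j)) same))

    covers : ∀ x y → Adj x y →
             Σ (Fin (length xs)) λ i → SameEdge (walk a xs (inject₁ i)) (walk a xs (fsuc i)) x y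
    covers x y xy with Any-at (a , a) (complete t xy tt)
    ... | k , k<n , same =
      i , subst (_≈ₑ (x , y)) (trans (cong (at (a , a) es) (sym (toℕ-fromℕ< k<xs))) (edge-at i)) same
      where
      k<xs : k < length xs
      k<xs = subst (k <_) (length-edges a xs) k<n
      i : Fin (length xs)
      i = fromℕ< k<xs

  avoidingCircuits⇒doublyEulerianAt : ∀ {a} → HasAvoidingCircuits a → DoublyEulerianAt a
  avoidingCircuits⇒doublyEulerianAt {a} (ps , qs , c) =
    suc (length ps) , walk a (ps ∷ʳ a) , walk a (qs ∷ʳ a) ,
    closedTrail⇒isEulerianCircuit a (ps ∷ʳ a) (length-∷ʳ ps) (endpoint-∷ʳ a ps a) circuit₁ ,
    closedTrail⇒isEulerianCircuit a (qs ∷ʳ a)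
      (trans (length-∷ʳ qs) (cong suc (sym (Pointwise-length avoiding))))
      (endpoint-∷ʳ a qs a) circuit₂ ,
    λ i → avoid-at (toℕ i)
    where
    open AvoidingCircuits c
    length-∷ʳ : ∀ xs → length (xs ∷ʳ a) ≡ suc (length xs)
    length-∷ʳ xs = trans (length-++ xs) (+-comm (length xs) 1)
    avoid-at : ∀ k → 0 < k → k < suc (length ps) →
               Avoid (at a (a ∷ ps ∷ʳ a) k) (at a (a ∷ qs ∷ʳ a) k)
    avoid-at (suc k) _ (s<s k<ps) = subst₂ Avoid (sym (at-++ˡ a ps [ a ] k k<ps))
      (sym (at-++ˡ a qs [ a ] k (subst (k <_) (Pointwise-length avoiding) k<ps)))
      (Pointwise-at a avoiding k k<ps)

-- Complete multipartite graphs K_{r×s}; a vertex is a pair (part, colour)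

Vertex : ℕ → ℕ → Set
Vertex r s = Fin r × Fin s

part : ∀ {r s} → Vertex r s → Fin r
part = proj₁

infix 4 _~_
_~_ : ∀ {r s} → Vertex r s → Vertex r s → Set
x ~ y = part x ≢ part y

module K (r s : ℕ) = Trails (_~_ {r} {s})

module _ {r s : ℕ} where
  open K r s

  _≟ᵥ_ : DecidableEquality (Vertex r s)
  _≟ᵥ_ = ≡-dec _≟ᶠ_ _≟ᶠ_

  _~?_ : Decidable (_~_ {r} {s})
  x ~? y = ¬? (part x ≟ᶠ part y)

  _≈ₑ?_ : Decidable _≈ₑ_
  (x , y) ≈ₑ? (a , b) = ((x ≟ᵥ a) ×-dec (y ≟ᵥ b)) ⊎-dec ((x ≟ᵥ b) ×-dec (y ≟ᵥ a))

  ∀-Vertex? : ∀ {P : Vertex r s → Set} → (∀ x → Dec (P x)) → Dec (∀ x → P x)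
  ∀-Vertex? P? = map′ (λ h (p , c) → h p c) (λ h p c → h (p , c))
                      (∀-Fin? λ p → ∀-Fin? λ c → P? (p , c))

  traversesAll? : ∀ es → Dec (TraversesAll es)
  traversesAll? es = map′
    (λ (adj , dist , comp) →
       record { adjacent = adj ; distinct = dist ; complete = λ {x} {y} xy _ → comp x y xy })
    (λ t → Traverses.adjacent t , Traverses.distinct t , λ x y xy → Traverses.complete t xy tt)
    (All.all? (λ (x , y) → x ~? y) es ×-dec
     AllPairs.allPairs? (λ e e′ → ¬? (e ≈ₑ? e′)) es ×-dec
     ∀-Vertex? λ x → ∀-Vertex? λ y → x ~? y →-dec Any.any? (_≈ₑ? (x , y)) es)

  avoidingCircuits? : ∀ a ps qs → Dec (AvoidingCircuits a ps qs)
  avoidingCircuits? a ps qs = map′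
    (λ (c₁ , c₂ , av) → record { circuit₁ = c₁ ; circuit₂ = c₂ ; avoiding = av })
    (λ c → AvoidingCircuits.circuit₁ c , AvoidingCircuits.circuit₂ c , AvoidingCircuits.avoiding c)
    (traversesAll? _ ×-dec traversesAll? _ ×-dec
     Pointwise.decidable (λ x y → ¬? (x ≟ᵥ y) ×-dec ¬? (x ~? y)) ps qs)

module VertexPermutation {r s : ℕ} (π : Permutation′ r) (ρ : Permutation′ s) where
  open K r s

  permute : Vertex r s → Vertex r s
  permute (p , c) = π ⟨$⟩ʳ p , ρ ⟨$⟩ʳ c

  permute⁻¹ : Vertex r s → Vertex r s
  permute⁻¹ (p , c) = π ⟨$⟩ˡ p , ρ ⟨$⟩ˡ c

  permute-inverseʳ : ∀ x → permute (permute⁻¹ x) ≡ x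
  permute-inverseʳ x = cong₂ _,_ (inverseʳ π) (inverseʳ ρ)

  permute-inverseˡ : ∀ x → permute⁻¹ (permute x) ≡ x
  permute-inverseˡ x = cong₂ _,_ (inverseˡ π) (inverseˡ ρ)

  permute-injective : ∀ {x y} → permute x ≡ permute y → x ≡ y
  permute-injective {x} {y} eq =
    trans (sym (permute-inverseˡ x)) (trans (cong permute⁻¹ eq) (permute-inverseˡ y))

  permute-~ : ∀ {x y} → x ~ y → permute x ~ permute y
  permute-~ x≁y eq = x≁y (trans (sym (inverseˡ π)) (trans (cong (π ⟨$⟩ˡ_) eq) (inverseˡ π)))

  permute-~⁻ : ∀ {x y} → permute x ~ permute y → x ~ y
  permute-~⁻ πx≁πy eq = πx≁πy (cong (π ⟨$⟩ʳ_) eq)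

  open TrailMaps (_~_ {r} {s}) (_~_ {r} {s}) permute permute-injective (λ {x} {y} → permute-~ {x} {y}) public
  open Isomorphism permute⁻¹ permute-inverseʳ (λ {x} {y} → permute-~⁻ {x} {y}) public


transpose-sends : ∀ {n} (i j : Fin n) → transpose i j ⟨$⟩ʳ i ≡ j
transpose-sends i j rewrite dec-true (i ≟ᶠ i) refl = refl

permute-transpose : ∀ {j t} (x : Vertex (suc (suc j)) (suc t)) →
  VertexPermutation.permute (transpose 1F (part x)) (transpose 0F (proj₂ x)) (1F , 0F) ≡ x
permute-transpose (p , c) = cong₂ _,_ (transpose-sends 1F p) (transpose-sends 0F c)

-- An Euler circuit of K_{2×4} at (1,0), found by computer search; `detour` uses that it
-- starts by stepping to (0,0).
template : List (Vertex 2 4)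
template =
  (0F , 0F) ∷ (1F , 1F) ∷ (0F , 1F) ∷ (1F , 2F) ∷ (0F , 2F) ∷ (1F , 3F) ∷ (0F , 3F) ∷ (1F , 0F) ∷
  (0F , 1F) ∷ (1F , 3F) ∷ (0F , 0F) ∷ (1F , 2F) ∷ (0F , 3F) ∷ (1F , 1F) ∷ (0F , 2F) ∷ (1F , 0F) ∷ []

template-traverses : K.TraversesAll 2 4 (K.edges 2 4 (1F , 0F) template)
template-traverses = from-yes (traversesAll? (K.edges 2 4 (1F , 0F) template))

-- Avoiding Euler circuits of K_{2×4} at (1,0), found by computer search. They start at (0,0)
-- and at its colour reversal (0,3), the shape that `AddPart.extend` preserves.
base₁ base₂ : List (Vertex 2 4)
base₁ =
  (1F , 3F) ∷ (0F , 3F) ∷ (1F , 0F) ∷ (0F , 2F) ∷ (1F , 3F) ∷ (0F , 1F) ∷ (1F , 2F) ∷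
  (0F , 0F) ∷ (1F , 1F) ∷ (0F , 3F) ∷ (1F , 2F) ∷ (0F , 2F) ∷ (1F , 1F) ∷ (0F , 1F) ∷ []
base₂ =
  (1F , 2F) ∷ (0F , 0F) ∷ (1F , 3F) ∷ (0F , 3F) ∷ (1F , 1F) ∷ (0F , 0F) ∷ (1F , 0F) ∷
  (0F , 1F) ∷ (1F , 3F) ∷ (0F , 2F) ∷ (1F , 1F) ∷ (0F , 1F) ∷ (1F , 2F) ∷ (0F , 2F) ∷ []

base : K.AvoidingCircuits 2 4 (1F , 0F) ((0F , 0F) ∷ base₁) ((0F , 3F) ∷ base₂)
base = from-yes (avoidingCircuits? (1F , 0F) ((0F , 0F) ∷ base₁) ((0F , 3F) ∷ base₂))

-- Adding a part to K_{r×4}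

inject₁-preimage : ∀ {n} (i : Fin (suc n)) → i ≢ fromℕ n → ∃ λ j → inject₁ j ≡ i
inject₁-preimage {n} i i≢top = lower₁ i n≢i , inject₁-lower₁ i n≢i
  where
  n≢i : n ≢ toℕ i
  n≢i n≡i = i≢top (toℕ-injective (trans (sym n≡i) (sym (toℕ-fromℕ n))))

reverse-fixpoint-free : ∀ (c : Fin 4) → reverse ⟨$⟩ʳ c ≢ c
reverse-fixpoint-free 0F ()
reverse-fixpoint-free 1F ()
reverse-fixpoint-free 2F ()
reverse-fixpoint-free 3F ()

module AddPart (k : ℕ) where
  r : ℕ
  r = suc k

  open K (suc r) 4

  top : Fin (suc r)
  top = fromℕ r

  TouchesTop : Vertex (suc r) 4 → Vertex (suc r) 4 → Set
  TouchesTop x y = part x ≡ top ⊎ part y ≡ top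

  TouchesTop-sym : Symmetric TouchesTop
  TouchesTop-sym (inj₁ x-top) = inj₂ x-top
  TouchesTop-sym (inj₂ y-top) = inj₁ y-top

  record IsDetour (b : Vertex (suc r) 4) (ds : List (Vertex (suc r) 4)) : Set where
    field
      closed     : ClosedAt b ds
      traverses  : Traverses TouchesTop (edges b ds)
      touchesTop : All (uncurry TouchesTop) (edges b ds)

  Between : Fin r → Vertex (suc r) 4 → Vertex (suc r) 4 → Set
  Between p x y = (part x ≡ inject₁ p × part y ≡ top) ⊎ (part x ≡ top × part y ≡ inject₁ p)

  Between-sym : ∀ {p} → Symmetric (Between p)
  Between-sym (inj₁ (x-p , y-top)) = inj₂ (y-top , x-p)
  Between-sym (inj₂ (x-top , y-p)) = inj₁ (y-p , x-top)

  Between-unique : ∀ {p q x y} → Between p x y → Between q x y → p ≡ q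
  Between-unique (inj₁ (x-p , _)) (inj₁ (x-q , _)) = inject₁-injective (trans (sym x-p) x-q)
  Between-unique (inj₂ (_ , y-p)) (inj₂ (_ , y-q)) = inject₁-injective (trans (sym y-p) y-q)
  Between-unique (inj₁ (x-p , _)) (inj₂ (x-top , _)) = ⊥-elim (fromℕ≢inject₁ (trans (sym x-top) x-p))
  Between-unique (inj₂ (x-top , _)) (inj₁ (x-q , _)) = ⊥-elim (fromℕ≢inject₁ (trans (sym x-top) x-q))

  top-or-inject₁ : ∀ (i : Fin (suc r)) → i ≡ top ⊎ ∃ λ p → inject₁ p ≡ i
  top-or-inject₁ i with i ≟ᶠ top
  ... | yes i≡top = inj₁ i≡top
  ... | no  i≢top = inj₂ (inject₁-preimage i i≢top)

  touchesTop⇒between : ∀ {x y} → x ~ y → TouchesTop x y → ∃ λ p → Between p x y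
  touchesTop⇒between {x} {y} x≁y (inj₁ x-top) with top-or-inject₁ (part y)
  ... | inj₁ y-top      = ⊥-elim (x≁y (trans x-top (sym y-top)))
  ... | inj₂ (p , y-p)  = p , inj₂ (x-top , sym y-p)
  touchesTop⇒between {x} {y} x≁y (inj₂ y-top) with top-or-inject₁ (part x)
  ... | inj₁ x-top      = ⊥-elim (x≁y (trans x-top (sym y-top)))
  ... | inj₂ (p , x-p)  = p , inj₁ (sym x-p , y-top)

  embed : Fin r → Vertex 2 4 → Vertex (suc r) 4
  embed p (0F , c) = inject₁ p , c
  embed p (1F , c) = top , c

  embed-injective : ∀ p {x y} → embed p x ≡ embed p y → x ≡ y
  embed-injective p {0F , c} {0F , d} refl = refl
  embed-injective p {1F , c} {1F , d} refl = refl
  embed-injective p {0F , c} {1F , d} eq   = ⊥-elim (fromℕ≢inject₁ (sym (cong proj₁ eq)))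
  embed-injective p {1F , c} {0F , d} eq   = ⊥-elim (fromℕ≢inject₁ (cong proj₁ eq))

  embed-between : ∀ p {x y} → x ~ y → Between p (embed p x) (embed p y)
  embed-between p {0F , c} {0F , d} x≁y = ⊥-elim (x≁y refl)
  embed-between p {0F , c} {1F , d} _   = inj₁ (refl , refl)
  embed-between p {1F , c} {0F , d} _   = inj₂ (refl , refl)
  embed-between p {1F , c} {1F , d} x≁y = ⊥-elim (x≁y refl)

  embed-~ : ∀ p {x y} → x ~ y → embed p x ~ embed p y
  embed-~ p {x} {y} x≁y with embed-between p {x} {y} x≁y
  ... | inj₁ (x-p , y-top) = λ eq → fromℕ≢inject₁ (trans (sym y-top) (trans (sym eq) x-p))
  ... | inj₂ (x-top , y-p) = λ eq → fromℕ≢inject₁ (trans (sym x-top) (trans eq y-p))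

  module Embed (p : Fin r) = TrailMaps _~_ _~_ (embed p) (embed-injective p) (λ {x} {y} → embed-~ p {x} {y})

  block : Fin r → List Edge
  block p = map (Embed.f₂ p) (K.edges 2 4 (1F , 0F) template)

  block-traverses : ∀ p → Traverses (Between p) (block p)
  block-traverses p = Embed.Traverses-map p lift template-traverses
    where
    lift : ∀ {x′ y′} → x′ ~ y′ → Between p x′ y′ →
           ∃₂ λ x y → embed p x ≡ x′ × embed p y ≡ y′ × x ~ y × _
    lift {_ , c} {_ , d} _ (inj₁ (refl , refl)) = (0F , c) , (1F , d) , refl , refl , (λ ()) , tt
    lift {_ , c} {_ , d} _ (inj₂ (refl , refl)) = (1F , c) , (0F , d) , refl , refl , (λ ()) , tt

  block-between : ∀ p → All (uncurry (Between p)) (block p)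
  block-between p = All.map⁺ {f = Embed.f₂ p}
    (All.map (λ {e} → embed-between p {proj₁ e} {proj₂ e}) (K.Traverses.adjacent template-traverses))

  between⇒touchesTop : ∀ {p x y} → Between p x y → TouchesTop x y
  between⇒touchesTop (inj₁ (_ , y-top)) = inj₂ y-top
  between⇒touchesTop (inj₂ (x-top , _)) = inj₁ x-top

  allBlocks : List Edge
  allBlocks = concat (tabulate block)

  allBlocks-traverses : Traverses TouchesTop allBlocks
  allBlocks-traverses = Traverses-weaken (λ {x} {y} → touchesTop⇒between {x} {y})
    (Traverses-concat block-traverses λ {i} {j} i≢j →
      separated {R = Between i} {R′ = Between j} (λ {x} {y} → Between-sym {j} {x} {y})
        (λ {x} {y} bi bj → i≢j (Between-unique {i} {j} {x} {y} bi bj)) (block-between i) (block-between j))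

  allBlocks-touchesTop : All (uncurry TouchesTop) allBlocks
  allBlocks-touchesTop = All.concat⁺ (All.tabulate⁺ {f = block} λ p →
    All.map (λ {e} → between⇒touchesTop {p} {proj₁ e} {proj₂ e}) (block-between p))

  templateCopy : Fin r → List (Vertex (suc r) 4)
  templateCopy p = map (embed p) template

  templateCopy-closed : All (ClosedAt (top , 0F)) (tabulate templateCopy)
  templateCopy-closed = All.tabulate⁺ {f = templateCopy} λ _ → refl

  tour : List (Vertex (suc r) 4)
  tour = concat (tabulate templateCopy)

  tour-closed : ClosedAt (top , 0F) tour
  tour-closed = endpoint-concat (top , 0F) templateCopy-closed

  edges-tour : edges (top , 0F) tour ≡ allBlocks
  edges-tour = begin
    edges (top , 0F) (concat (tabulate templateCopy))
      ≡⟨ edges-concat (top , 0F) templateCopy-closed ⟩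
    concat (map (edges (top , 0F)) (tabulate templateCopy))
      ≡⟨ cong concat (map-tabulate templateCopy (edges (top , 0F))) ⟩
    concat (tabulate (edges (top , 0F) ∘ templateCopy))
      ≡⟨ cong concat (tabulate-cong {f = edges (top , 0F) ∘ templateCopy} {g = block}
                       λ p → Embed.edges-map p (1F , 0F) template) ⟩
    allBlocks
      ∎
    where open ≡-Reasoning

  -- `tour` is a closed walk at (top , 0) whose first step goes to (0 , 0); rotated to start
  -- there, it is a closed trail at (0 , 0) with the same edges.
  detour : List (Vertex (suc r) 4)
  detour = drop 1 tour ∷ʳ (0F , 0F)

  allBlocks↭detour : allBlocks ↭ edges (0F , 0F) detour
  allBlocks↭detour = subst (_↭ edges (0F , 0F) detour) edges-tour
    (edges-rotate (top , 0F) (0F , 0F) (drop 1 tour) tour-closed)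

  detour-isDetour : IsDetour (0F , 0F) detour
  detour-isDetour = record
    { closed     = endpoint-∷ʳ (0F , 0F) (drop 1 tour) (0F , 0F)
    ; traverses  = Traverses-resp-↭ allBlocks↭detour allBlocks-traverses
    ; touchesTop = All-resp-↭ allBlocks↭detour allBlocks-touchesTop
    }

  ι : Vertex r 4 → Vertex (suc r) 4
  ι (p , c) = inject₁ p , c

  ι-injective : ∀ {x y} → ι x ≡ ι y → x ≡ y
  ι-injective {p , c} {q , d} eq = cong₂ _,_ (inject₁-injective (cong proj₁ eq)) (cong proj₂ eq)

  ι-~ : ∀ {x y} → x ~ y → ι x ~ ι y
  ι-~ x≁y eq = x≁y (inject₁-injective eq)

  ι-~⁻ : ∀ {x y} → ι x ~ ι y → x ~ y
  ι-~⁻ ιx≁ιy eq = ιx≁ιy (cong inject₁ eq)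

  module Include = TrailMaps _~_ _~_ ι ι-injective (λ {x} {y} → ι-~ {x} {y})

  Old : Vertex (suc r) 4 → Vertex (suc r) 4 → Set
  Old x y = ¬ TouchesTop x y

  ι-old : ∀ x y → Old (ι x) (ι y)
  ι-old x y (inj₁ x-top) = fromℕ≢inject₁ (sym x-top)
  ι-old x y (inj₂ y-top) = fromℕ≢inject₁ (sym y-top)

  Traverses-include : ∀ {es} → K.TraversesAll r 4 es → Traverses Old (map Include.f₂ es)
  Traverses-include = Include.Traverses-map lift
    where
    lift : ∀ {x′ y′} → x′ ~ y′ → Old x′ y′ →
           ∃₂ λ x y → ι x ≡ x′ × ι y ≡ y′ × x ~ y × _
    lift {p′ , c} {q′ , d} x′≁y′ old with top-or-inject₁ p′ | top-or-inject₁ q′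
    ... | inj₁ x-top      | _               = ⊥-elim (old (inj₁ x-top))
    ... | inj₂ _          | inj₁ y-top      = ⊥-elim (old (inj₂ y-top))
    ... | inj₂ (p , refl) | inj₂ (q , refl) =
      (p , c) , (q , d) , refl , refl , ι-~⁻ {p , c} {q , d} x′≁y′ , tt

  insertDetour : ∀ {a b xs ds} → K.TraversesAll r 4 (K.edges r 4 a (b ∷ xs ∷ʳ a)) → IsDetour (ι b) ds →
                 TraversesAll (edges (ι a) ((ι b ∷ ds ++ map ι xs) ∷ʳ ι a))
  insertDetour {a} {b} {xs} {ds} old detour =
    subst TraversesAll (cong (λ ys → edges (ι a) (ι b ∷ ys)) (sym (++-assoc ds (map ι xs) [ ι a ])))
      (Traverses-resp-↭ (↭-sym (edges-splice (ι a) (ι b) ds (map ι xs ∷ʳ ι a) closed))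
        (Traverses-weaken (λ {x} {y} _ _ → Sum.swap (toSum (touchesTop? x y)))
          (Traverses-++ old′ traverses (separated {R = Old} {R′ = TouchesTop} (λ {x} {y} → TouchesTop-sym {x} {y})
                          (λ old touches → old touches) old′-old touchesTop))))
    where
    open IsDetour detour
    old′ : Traverses Old (edges (ι a) (map ι (b ∷ xs) ∷ʳ ι a))
    old′ = subst (Traverses Old) (sym (Include.edges-map-∷ʳ a (b ∷ xs))) (Traverses-include old)
    old′-old : All (uncurry Old) (edges (ι a) (map ι (b ∷ xs) ∷ʳ ι a))
    old′-old = subst (All (uncurry Old)) (sym (Include.edges-map-∷ʳ a (b ∷ xs)))
                 (All.map⁺ (All.universal (λ (x , y) → ι-old x y) _))
    touchesTop? : ∀ x y → Dec (TouchesTop x y)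
    touchesTop? x y = (part x ≟ᶠ top) ⊎-dec (part y ≟ᶠ top)

  module Reverse = VertexPermutation {suc r} {4} idₚ reverse

  ρ : Vertex (suc r) 4 → Vertex (suc r) 4
  ρ = Reverse.permute

  avoid-ρ : ∀ x → Avoid x (ρ x)
  avoid-ρ (p , c) = (λ eq → reverse-fixpoint-free c (sym (cong proj₂ eq))) , (λ x≁ρx → x≁ρx refl)

  avoid-map-ρ : ∀ xs → Pointwise Avoid xs (map ρ xs)
  avoid-map-ρ []       = []
  avoid-map-ρ (x ∷ xs) = avoid-ρ x ∷ avoid-map-ρ xs

  IsDetour-ρ : ∀ {b ds} → IsDetour b ds → IsDetour (ρ b) (map ρ ds)
  IsDetour-ρ {b} {ds} d = record
    { closed     = trans (Reverse.endpoint-map b ds) (cong ρ closed)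
    ; traverses  = subst (Traverses TouchesTop) (sym (Reverse.edges-map b ds))
                     (Reverse.Traverses-map-iso (λ touches → touches) traverses)
    ; touchesTop = subst (All (uncurry TouchesTop)) (sym (Reverse.edges-map b ds)) (All.map⁺ touchesTop)
    }
    where open IsDetour d

  extend : ∀ {a ps qs} → K.AvoidingCircuits r 4 a ((0F , 0F) ∷ ps) ((0F , 3F) ∷ qs) →
           AvoidingCircuits (ι a) ((0F , 0F) ∷ detour ++ map ι ps) ((0F , 3F) ∷ map ρ detour ++ map ι qs)
  extend c = record
    { circuit₁ = insertDetour circuit₁ detour-isDetour
    ; circuit₂ = insertDetour circuit₂ (IsDetour-ρ detour-isDetour)
    ; avoiding = avoid-ρ (0F , 0F) ∷ Pointwise.++⁺ (avoid-map-ρ detour)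
        (Pointwise.map⁺ ι ι (Pointwise.map (Include.Avoid-map (λ {x} {y} → ι-~⁻ {x} {y}))
                                          (Pointwise.tail avoiding)))
    }
    where open K.AvoidingCircuits r 4 c

-- Cay(ℤ_{rs}, {z : r ∤ z}) is K_{r×s}

[m+n]%d≡n⇒m≡0 : ∀ {m n d} .{{_ : NonZero d}} → m < d → (m + n) % d ≡ n → m ≡ 0
[m+n]%d≡n⇒m≡0 {m} {n} {d} m<d eq = quotient-zero ((m + n) / d) m≡q*d
  where
  m≡q*d : m ≡ ((m + n) / d) * d
  m≡q*d = +-cancelʳ-≡ n m _ (begin
    m + n                             ≡⟨ m≡m%n+[m/n]*n (m + n) d ⟩
    (m + n) % d + ((m + n) / d) * d   ≡⟨ cong (_+ ((m + n) / d) * d) eq ⟩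
    n + ((m + n) / d) * d             ≡⟨ +-comm n _ ⟩
    ((m + n) / d) * d + n             ∎)
    where open ≡-Reasoning
  quotient-zero : ∀ q → m ≡ q * d → m ≡ 0
  quotient-zero zero    m≡0     = m≡0
  quotient-zero (suc q) m≡d+q*d = ⊥-elim (<⇒≱ m<d (subst (d ≤_) (sym m≡d+q*d) (m≤m+n d (q * d))))

[y+[n∸x]]%d≡0⇔ : ∀ {d n x y} .{{_ : NonZero d}} → d ∣ n → x ≤ n →
                  (y + (n ∸ x)) % d ≡ 0 ⇔ x % d ≡ y % d
[y+[n∸x]]%d≡0⇔ {d} {n} {x} {y} d∣n x≤n = mk⇔
  (λ A%d≡0 → begin
    x % d                   ≡⟨ m%n%n≡m%n x d ⟨
    (0 + x % d) % d         ≡⟨ cong (λ a → (a + x % d) % d) A%d≡0 ⟨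
    (A % d + x % d) % d     ≡⟨ split ⟨
    (A + x) % d             ≡⟨ wrap ⟩
    y % d                   ∎)
  (λ x≡y → [m+n]%d≡n⇒m≡0 (m%n<n A d) (trans (sym split) (trans wrap (sym x≡y))))
  where
  open ≡-Reasoning
  A = y + (n ∸ x)
  split : (A + x) % d ≡ (A % d + x % d) % d
  split = %-distribˡ-+ A x d
  wrap : (A + x) % d ≡ y % d
  wrap = trans (cong (_% d) (trans (+-assoc y (n ∸ x) x) (cong (y +_) (m∸n+n≡m x≤n))))
               (%-remove-+ʳ y d∣n)


countᵇ : (ℕ → Bool) → ℕ → ℕ
countᵇ f zero    = 0
countᵇ f (suc N) = (if f 0 then 1 else 0) + countᵇ (f ∘ suc) N

∣tabulate∣≡countᵇ : ∀ N (f : ℕ → Bool) → ∣ Vec.tabulate {n = N} (f ∘ toℕ) ∣ ≡ countᵇ f N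
∣tabulate∣≡countᵇ zero    f = refl
∣tabulate∣≡countᵇ (suc N) f with f 0
... | true  = cong suc (∣tabulate∣≡countᵇ N (f ∘ suc))
... | false = ∣tabulate∣≡countᵇ N (f ∘ suc)

countᵇ-cong : ∀ {f g} N → (∀ i → i < N → f i ≡ g i) → countᵇ f N ≡ countᵇ g N
countᵇ-cong zero    f≡g = refl
countᵇ-cong (suc N) f≡g = cong₂ _+_ (cong (λ b → if b then 1 else 0) (f≡g 0 z<s))
                                    (countᵇ-cong N (λ i i<N → f≡g (suc i) (s<s i<N)))

countᵇ-+ : ∀ f m N → countᵇ f (m + N) ≡ countᵇ f m + countᵇ (λ i → f (m + i)) N
countᵇ-+ f zero    N = refl
countᵇ-+ f (suc m) N = trans (cong (_ +_) (countᵇ-+ (f ∘ suc) m N))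
  (sym (+-assoc (if f 0 then 1 else 0) (countᵇ (f ∘ suc) m) _))

countᵇ-periodic : ∀ {f} r → (∀ i → f (r + i) ≡ f i) → ∀ q → countᵇ f (q * r) ≡ q * countᵇ f r
countᵇ-periodic         r periodic zero    = refl
countᵇ-periodic {f} r periodic (suc q) = begin
  countᵇ f (r + q * r)                         ≡⟨ countᵇ-+ f r (q * r) ⟩
  countᵇ f r + countᵇ (λ i → f (r + i)) (q * r) ≡⟨ cong (countᵇ f r +_) (countᵇ-cong (q * r) (λ i _ → periodic i)) ⟩
  countᵇ f r + countᵇ f (q * r)                 ≡⟨ cong (countᵇ f r +_) (countᵇ-periodic r periodic q) ⟩
  countᵇ f r + q * countᵇ f r                   ∎
  where open ≡-Reasoning

countᵇ-false : ∀ N → countᵇ (λ _ → false) N ≡ 0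
countᵇ-false zero    = refl
countᵇ-false (suc N) = countᵇ-false N

countᵇ-singleton : ∀ {k N} → k < N → countᵇ (λ i → does (k ≟ i)) N ≡ 1
countᵇ-singleton {zero}  {suc N} _         = cong suc (countᵇ-false N)
countᵇ-singleton {suc k} {suc N} (s<s k<N) = countᵇ-singleton k<N

not-does : ∀ {P : Set} (P? : Dec P) → not (does P?) ≡ true ⇔ (¬ P)
not-does (yes p)  = mk⇔ (λ ()) (λ ¬p → ⊥-elim (¬p p))
not-does (no ¬p)  = mk⇔ (λ _ → ¬p) (λ _ → refl)

module CayleyMultipartite (r s : ℕ) .{{_ : NonZero r}} .{{_ : NonZero s}} where

  n : ℕ
  n = r * s

  instance
    n≢0 : NonZero n
    n≢0 = m*n≢0 r s

  S : Subset n
  S = Vec.tabulate λ z → not (does (toℕ z % r ≟ 0))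

  S-lookup : ∀ z → Vec.lookup S z ≡ not (does (toℕ z % r ≟ 0))
  S-lookup = Vec.lookup∘tabulate _

  ∈S⇔ : ∀ z → z ∈ S ⇔ toℕ z % r ≢ 0
  ∈S⇔ z = mk⇔
    (λ z∈S → Equivalence.to (not-does (toℕ z % r ≟ 0)) (trans (sym (S-lookup z)) (Vec.[]=⇒lookup z∈S)))
    (λ z≢0 → Vec.lookup⇒[]= z S (trans (S-lookup z) (Equivalence.from (not-does (toℕ z % r ≟ 0)) z≢0)))

  r∣n : r ∣ n
  r∣n = m∣m*n s

  toℕ-mod-%r : ∀ m → toℕ (m mod n) % r ≡ m % r
  toℕ-mod-%r m = trans (cong (_% r) (toℕ-fromℕ< _)) (m∣n⇒o%n%m≡o%m r n m r∣n)

  sameResidue⇔ : ∀ (x y : Fin n) → toℕ (y ⊖ x) % r ≡ 0 ⇔ toℕ x % r ≡ toℕ y % r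
  sameResidue⇔ x y = subst (λ a → a ≡ 0 ⇔ (toℕ x % r ≡ toℕ y % r)) (sym (toℕ-mod-%r _))
    ([y+[n∸x]]%d≡0⇔ r∣n (<⇒≤ (toℕ<n x)))

  neighbour-lookup : ∀ x y → Vec.lookup S (y ⊖ x) ≡ not (does (toℕ x % r ≟ toℕ y % r))
  neighbour-lookup x y = trans (S-lookup (y ⊖ x))
    (cong not (does-⇔ (sameResidue⇔ x y) (toℕ (y ⊖ x) % r ≟ 0) (toℕ x % r ≟ toℕ y % r)))

  adjacent⇔ : ∀ x y → CayAdj S x y ⇔ toℕ x % r ≢ toℕ y % r
  adjacent⇔ x y = mk⇔
    (λ xy same → Equivalence.to (∈S⇔ (y ⊖ x)) xy (Equivalence.from (sameResidue⇔ x y) same))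
    (λ differ → Equivalence.from (∈S⇔ (y ⊖ x)) (differ ∘ Equivalence.to (sameResidue⇔ x y)))

  residueClass : Fin n → Subset n
  residueClass x = Vec.tabulate λ y → does (toℕ x % r ≟ toℕ y % r)

  neighbours≡∁residueClass : ∀ x → neighbours S x ≡ ∁ (residueClass x)
  neighbours≡∁residueClass x = trans (Vec.tabulate-cong (neighbour-lookup x)) (Vec.tabulate-∘ not _)

  ∣residueClass∣≡s : ∀ x → ∣ residueClass x ∣ ≡ s
  ∣residueClass∣≡s x = begin
    ∣ residueClass x ∣   ≡⟨ ∣tabulate∣≡countᵇ n inClass ⟩
    countᵇ inClass n     ≡⟨ cong (countᵇ inClass) (*-comm r s) ⟩
    countᵇ inClass (s * r) ≡⟨ countᵇ-periodic r periodic s ⟩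
    s * countᵇ inClass r ≡⟨ cong (s *_) one-per-period ⟩
    s * 1                ≡⟨ *-identityʳ s ⟩
    s                    ∎
    where
    open ≡-Reasoning
    k = toℕ x % r
    inClass : ℕ → Bool
    inClass i = does (k ≟ i % r)
    periodic : ∀ i → inClass (r + i) ≡ inClass i
    periodic i = cong (λ j → does (k ≟ j)) (trans (cong (_% r) (+-comm r i)) ([m+n]%n≡m%n i r))
    one-per-period : countᵇ inClass r ≡ 1
    one-per-period = trans (countᵇ-cong r λ i i<r → cong (λ j → does (k ≟ j)) (m<n⇒m%n≡m i<r))
                           (countᵇ-singleton (m%n<n (toℕ x) r))

  regular : IsRegular S (n ∸ s)
  regular x = begin
    ∣ neighbours S x ∣          ≡⟨ cong ∣_∣ (neighbours≡∁residueClass x) ⟩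
    ∣ ∁ (residueClass x) ∣      ≡⟨ ∣∁p∣≡n∸∣p∣ (residueClass x) ⟩
    n ∸ ∣ residueClass x ∣      ≡⟨ cong (n ∸_) (∣residueClass∣≡s x) ⟩
    n ∸ s                       ∎
    where open ≡-Reasoning

  0%r≡0 : 0 % r ≡ 0
  0%r≡0 = m<n⇒m%n≡m (>-nonZero⁻¹ r)

  0∉S : (0 mod n) ∉ S
  0∉S 0∈S = Equivalence.to (∈S⇔ (0 mod n)) 0∈S (trans (toℕ-mod-%r 0) 0%r≡0)

  negₙ-∈S : ∀ z → z ∈ S → negₙ z ∈ S
  negₙ-∈S z z∈S = Equivalence.from (∈S⇔ (negₙ z)) λ -z%r≡0 → Equivalence.to (∈S⇔ z) z∈S
    (trans (Equivalence.to ([y+[n∸x]]%d≡0⇔ r∣n (<⇒≤ (toℕ<n z))) (trans (sym (toℕ-mod-%r _)) -z%r≡0))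
           0%r≡0)

  connectionSet : IsConnectionSet S
  connectionSet = 0∉S , negₙ-∈S

  -- (p , c) ↦ p + r c, so the part of a vertex becomes its residue mod r.
  φ : Vertex r s → Fin n
  φ (p , c) = cast (*-comm s r) (combine c p)

  φ⁻¹ : Fin n → Vertex r s
  φ⁻¹ z = Product.swap (remQuot r (cast (*-comm r s) z))

  φ-inverseʳ : ∀ z → φ (φ⁻¹ z) ≡ z
  φ-inverseʳ z = trans (cong (cast (*-comm s r)) (combine-remQuot {s} r (cast (*-comm r s) z)))
                       (cast-involutive (*-comm s r) (*-comm r s) z)

  φ-inverseˡ : ∀ x → φ⁻¹ (φ x) ≡ x
  φ-inverseˡ (p , c) = cong Product.swap (trans
    (cong (remQuot r) (cast-involutive (*-comm r s) (*-comm s r) (combine c p))) (remQuot-combine c p))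

  φ-injective : ∀ {x y} → φ x ≡ φ y → x ≡ y
  φ-injective {x} {y} eq = trans (sym (φ-inverseˡ x)) (trans (cong φ⁻¹ eq) (φ-inverseˡ y))

  φ-residue : ∀ x → toℕ (φ x) % r ≡ toℕ (part x)
  φ-residue (p , c) = begin
    toℕ (φ (p , c)) % r         ≡⟨ cong (_% r) (trans (toℕ-cast _ (combine c p)) (toℕ-combine c p)) ⟩
    (r * toℕ c + toℕ p) % r     ≡⟨ %-remove-+ˡ (toℕ p) (m∣m*n (toℕ c)) ⟩
    toℕ p % r                   ≡⟨ m<n⇒m%n≡m (toℕ<n p) ⟩
    toℕ p                       ∎
    where open ≡-Reasoning

  φ-~ : ∀ {x y} → x ~ y → CayAdj S (φ x) (φ y)
  φ-~ {x} {y} x≁y = Equivalence.from (adjacent⇔ (φ x) (φ y)) λ same →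
    x≁y (toℕ-injective (trans (sym (φ-residue x)) (trans same (φ-residue y))))

  φ-~⁻ : ∀ {x y} → CayAdj S (φ x) (φ y) → x ~ y
  φ-~⁻ {x} {y} φxφy x≡y = Equivalence.to (adjacent⇔ (φ x) (φ y)) φxφy
    (trans (φ-residue x) (trans (cong toℕ x≡y) (sym (φ-residue y))))

  open TrailMaps _~_ (CayAdj S) φ φ-injective (λ {x} {y} → φ-~ {x} {y})
  open Isomorphism φ⁻¹ φ-inverseʳ (λ {x} {y} → φ-~⁻ {x} {y}) public

  adjacent-parts : ∀ x y → part (φ⁻¹ x) ≢ part (φ⁻¹ y) → CayAdj S x y
  adjacent-parts x y differ = subst₂ (CayAdj S) (φ-inverseʳ x) (φ-inverseʳ y) (φ-~ {φ⁻¹ x} {φ⁻¹ y} differ)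

  connected : ∀ (p₀ p₁ : Fin r) → p₀ ≢ p₁ → GraphNotions.Connected (CayAdj S)
  connected p₀ p₁ p₀≢p₁ x y with part (φ⁻¹ x) ≟ᶠ part (φ⁻¹ y)
  ... | no differ = 1 , (λ { fzero → x ; (fsuc _) → y }) , refl , refl ,
                    λ { fzero → adjacent-parts x y differ }
  ... | yes same  = 2 , (λ { fzero → x ; (fsuc fzero) → z ; (fsuc (fsuc _)) → y }) , refl , refl ,
                    λ { fzero → adjacent-parts x z (λ eq → q≢ (trans (sym part-z) (sym eq)))
                      ; (fsuc fzero) → adjacent-parts z y (λ eq → q≢ (trans (sym part-z) (trans eq (sym same)))) }
    where
    otherPart : ∀ p → ∃ λ q → q ≢ p
    otherPart p with p ≟ᶠ p₀
    ... | yes refl = p₁ , p₀≢p₁ ∘ sym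
    ... | no p≢p₀  = p₀ , p≢p₀ ∘ sym
    q = proj₁ (otherPart (part (φ⁻¹ x)))
    q≢ : q ≢ part (φ⁻¹ x)
    q≢ = proj₂ (otherPart (part (φ⁻¹ x)))
    z : Fin n
    z = φ (q , proj₂ (φ⁻¹ x))
    part-z : part (φ⁻¹ z) ≡ q
    part-z = cong part (φ-inverseˡ (q , proj₂ (φ⁻¹ x)))

Seed : ℕ → Set
Seed j = ∃₂ λ ps qs → K.AvoidingCircuits (suc (suc j)) 4 (1F , 0F) ((0F , 0F) ∷ ps) ((0F , 3F) ∷ qs)

grow : ∀ {j} → Seed j → Seed (suc j)
grow {j} (_ , _ , c) = _ , _ , AddPart.extend (suc j) c

seed : ∀ j → Seed j
seed zero    = base₁ , base₂ , base
seed (suc j) = grow (seed j)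

avoidingCircuitsAt : ∀ {j} (x : Vertex (suc (suc j)) 4) → K.HasAvoidingCircuits _ 4 x
avoidingCircuitsAt {j} x@(p , c) with seed j
... | _ , _ , circuits = subst (K.HasAvoidingCircuits _ 4) (permute-transpose x)
  (VertexPermutation.HasAvoidingCircuits-map (transpose 1F p) (transpose 0F c) (_ , _ , circuits))

doublyEulerian : ∀ j → GraphNotions.DoublyEulerian (CayAdj (CayleyMultipartite.S (suc (suc j)) 4))
doublyEulerian j u = avoidingCircuits⇒doublyEulerianAt (CayAdj S)
  (subst (Trails.HasAvoidingCircuits (CayAdj S)) (φ-inverseʳ u)
         (HasAvoidingCircuits-map (avoidingCircuitsAt (φ⁻¹ u))))
  where open CayleyMultipartite (suc (suc j)) 4

theorem3 : (n : ℕ) → 4 ∣ n → (h : 8 ≤ n) →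
    Σ (Subset n) λ S →
      IsConnectionSet {n} {{>-nonZero (≤-trans (s≤s z≤n) h)}} S ×
      GraphNotions.Connected (CayAdj {n} {{>-nonZero (≤-trans (s≤s z≤n) h)}} S) ×
      IsRegular {n} {{>-nonZero (≤-trans (s≤s z≤n) h)}} S (n ∸ 4) ×
      GraphNotions.DoublyEulerian (CayAdj {n} {{>-nonZero (≤-trans (s≤s z≤n) h)}} S)
theorem3 .0 (divides 0 refl) ()
theorem3 .4 (divides 1 refl) (s≤s (s≤s (s≤s (s≤s ()))))
theorem3 .(suc (suc j) * 4) (divides (suc (suc j)) refl) _ =
  S , connectionSet , connected 0F 1F (λ ()) , regular , doublyEulerian j
  where open CayleyMultipartite (suc (suc j)) 4
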